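{- Let $q$ be an odd prime power and $SQ=\{x^2:x\in\mathbb{F}_q\}\setminus\{0\}$. Let $PL(\mathbb{F}_q^2)$ be the bipartite graph with parts $A=\{(a,b,c,\lambda)\in\mathbb{F}_q^4:(a^2+b^2)\lambda\in SQ\}$ and $B=\mathbb{F}_q^2$, where $(a,b,c,\lambda)\in A$ is adjacent to $(x,y)\in B$ iff $(ax+by+c)^2=\lambda(a^2+b^2)$. Then every vertex of $A$ has degree $2q$, and every vertex of $B$ has degree $2|S|$, where $S=\{(a,b,\lambda)\in\mathbb{F}_q^3:\lambda(a^2+b^2)\in SQ\}$. -}

module Defs where

open import Level using (Level; suc; _⊔_)
open import Data.Nat using (ℕ; _^_; _≡ᵇ_) renaming (suc to sucℕ)
open import Data.Nat.Primality using (Prime)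
open import Data.Nat.Divisibility using (_∣_)
open import Data.Fin using (Fin)
open import Data.List using (List; map; concatMap; length; filter)
open import Data.Bool.ListAction using (any)
open import Data.List.Base using (allFin)
open import Data.Bool using (Bool; true; false; not; _∧_; T)
open import Data.Nat renaming (_*_ to _ℕ*_) using ()
open import Data.Product using (_×_; _,_; Σ; ∃)
open import Relation.Nullary using (¬_; Dec; does)
open import Relation.Unary using (Pred)
open import Relation.Binary.PropositionalEquality using (_≡_; _≢_)
open import Algebra.Bundles using (CommutativeRing)
open import Algebra.Structures using (IsCommutativeRing)
open import Function.Bundles using (_↔_; Inverse)

-- A finite field: a commutative ring (w.r.t. propositional equality) with
-- 0 ≠ 1, multiplicative inverses of nonzero elements, decidable equality,
-- and an explicit enumeration Fin size ↔ Carrier (so |F| = size).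
record FiniteField (ℓ : Level) : Set (suc ℓ) where
  infixl 7 _*_
  infixl 6 _+_
  field
    Carrier : Set ℓ
    _+_ _*_ : Carrier → Carrier → Carrier
    -_ : Carrier → Carrier
    0# 1# : Carrier
    isCommutativeRing : IsCommutativeRing _≡_ _+_ _*_ -_ 0# 1#
    0≢1 : 0# ≢ 1#
    inverse : ∀ x → x ≢ 0# → ∃ λ y → x * y ≡ 1#
    _≟_ : (x y : Carrier) → Dec (x ≡ y)
    size : ℕ
    enum : Fin size ↔ Carrier

  elems : List Carrier
  elems = map (Inverse.to enum) (allFin size)

  inSQ : Carrier → Bool
  inSQ x = not (does (x ≟ 0#)) ∧ any (λ y → does ((y * y) ≟ x)) elems

  sq : Carrier → Carrier
  sq x = x * x

  elems² : List (Carrier × Carrier)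
  elems² = concatMap (λ x → map (x ,_) elems) elems

  elems³ : List (Carrier × Carrier × Carrier)
  elems³ = concatMap (λ x → map (x ,_) elems²) elems

  elems⁴ : List (Carrier × Carrier × Carrier × Carrier)
  elems⁴ = concatMap (λ x → map (x ,_) elems³) elems

  inA : Carrier × Carrier × Carrier × Carrier → Bool
  inA (a , b , c , l) = inSQ ((sq a + sq b) * l)

  inS : Carrier × Carrier × Carrier → Bool
  inS (a , b , l) = inSQ (l * (sq a + sq b))

  adj : Carrier × Carrier × Carrier × Carrier → Carrier × Carrier → Bool
  adj (a , b , c , l) (x , y) = does (sq (a * x + b * y + c) ≟ (l * (sq a + sq b)))

count : ∀ {a} {A : Set a} → (A → Bool) → List A → ℕ
count p xs = length (filter (λ x → Data.Bool._≟_ (p x) true) xs)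

OddPrimePower : ℕ → Set
OddPrimePower n = Σ ℕ λ p → Σ ℕ λ k → Prime p × ¬ (2 ∣ p) × n ≡ p ^ sucℕ k

PLDegrees : ∀ {ℓ} → FiniteField ℓ → Set ℓ
PLDegrees F =
  (∀ (v : Carrier × Carrier × Carrier × Carrier) → T (inA v) →
     count (adj v) elems² ≡ 2 ℕ* size)
  × (∀ (w : Carrier × Carrier) →
     count (λ v → inA v ∧ adj v w) elems⁴ ≡ 2 ℕ* count inS elems³)
  where open FiniteField F

-- Adjacency of (a,b,c,λ) with (x,y) says ax + by + c = ±s, where s² = λ(a²+b²) ≠ 0.  In odd
-- characteristic s ≠ -s, so for k ≠ 0 the equation (kx + m)² = s² has exactly two solutions x.
-- A vertex of A has (a,b) ≠ (0,0): solving for y (or for x when b = 0) leaves the other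
-- coordinate free, which gives 2q neighbours.  A vertex (x,y) of B is adjacent to (a,b,c,λ)
-- exactly when (a,b,λ) ∈ S and c is one of the two roots, which gives 2|S| neighbours.
-- Odd q excludes characteristic 2, where x ↦ x + 1 would pair off the elements of F.

module Submission where

open import Defs
open import Level using (Level)
open import Algebra.Bundles using (CommutativeRing)
import Algebra.Properties.Ring as RingProperties
open import Algebra.Properties.CommutativeSemigroup using (interchange)
open import Data.Bool using (Bool; true; false; not; _∧_; T)
open import Data.Fin as Fin using (Fin)
import Data.Fin.Properties as Fin
open import Data.List using (List; []; _∷_; _++_; map; concatMap; length; allFin)
open import Data.List.Properties using (map-cong; map-++; map-∘; length-map; length-tabulate)
open import Data.List.Membership.Propositional using (_∈_)
open import Data.List.Membership.Propositional.Properties using (∈-map⁺; ∈-allFin)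
open import Data.List.Relation.Unary.All as All using (All; []; _∷_)
open import Data.List.Relation.Unary.Any using (here; there; satisfied)
open import Data.List.Relation.Unary.Any.Properties using (any⁻)
open import Data.List.Relation.Unary.Unique.Propositional using (Unique; _∷_)
import Data.List.Relation.Unary.Unique.Propositional.Properties as Unique
open import Data.Nat as Nat using (ℕ; zero; suc; _^_)
open import Data.Nat.Divisibility using (_∣_; divides; ∣1⇒≡1)
open import Data.Nat.ListAction using (sum)
open import Data.Nat.ListAction.Properties using (sum-++)
open import Data.Nat.Primality using (Prime; euclidsLemma; prime[2]; ¬prime[1])
import Data.Nat.Properties as ℕ
open import Data.Product using (_×_; _,_; ∃; proj₁; proj₂)
open import Data.Sum using (_⊎_; inj₁; inj₂; [_,_])
open import Data.Unit using (tt)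
open import Function using (_∘_; Inverse; Injection; mk⇔)
open import Function.Properties.Inverse using (↔⇒↣; ↔-sym)
open import Relation.Binary.Definitions using (DecidableEquality; tri<; tri≈; tri>)
open import Relation.Binary.PropositionalEquality hiding ([_])
open import Relation.Nullary using (¬_; Dec; does; yes; no; contradiction)
open import Relation.Nullary.Decidable using (dec-true; dec-false; does-⇔)

T-does⇒ : ∀ {p} {P : Set p} (P? : Dec P) → T (does P?) → P
T-does⇒ (yes p) _ = p

𝟙 : Bool → ℕ
𝟙 true = 1
𝟙 false = 0

𝟙-not : ∀ b → 𝟙 b Nat.+ 𝟙 (not b) ≡ 1
𝟙-not true = refl
𝟙-not false = refl

∑ : ∀ {a} {A : Set a} → List A → (A → ℕ) → ℕ
∑ xs f = sum (map f xs)

syntax ∑ xs (λ x → e) = ∑[ x ∈ xs ] e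

module _ {a} {A : Set a} where
  open Nat using (_+_; _*_)

  count≡∑𝟙 : (p : A → Bool) (xs : List A) → count p xs ≡ ∑[ x ∈ xs ] 𝟙 (p x)
  count≡∑𝟙 p [] = refl
  count≡∑𝟙 p (x ∷ xs) with p x
  ... | true = cong suc (count≡∑𝟙 p xs)
  ... | false = count≡∑𝟙 p xs

  ∑-cong : {f g : A → ℕ} → (∀ x → f x ≡ g x) → (xs : List A) → ∑ xs f ≡ ∑ xs g
  ∑-cong f≗g xs = cong sum (map-cong f≗g xs)

  ∑-+ : (f g : A → ℕ) (xs : List A) → ∑[ x ∈ xs ] (f x + g x) ≡ ∑ xs f + ∑ xs g
  ∑-+ f g [] = refl
  ∑-+ f g (x ∷ xs) = begin
    (f x + g x) + ∑[ x ∈ xs ] (f x + g x)  ≡⟨ cong (f x + g x +_) (∑-+ f g xs) ⟩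
    (f x + g x) + (∑ xs f + ∑ xs g)
      ≡⟨ interchange ℕ.+-commutativeSemigroup (f x) (g x) _ _ ⟩
    (f x + ∑ xs f) + (g x + ∑ xs g)         ∎
    where open ≡-Reasoning

  ∑-*ˡ : (k : ℕ) (f : A → ℕ) (xs : List A) → ∑[ x ∈ xs ] (k * f x) ≡ k * ∑ xs f
  ∑-*ˡ k f [] = sym (ℕ.*-zeroʳ k)
  ∑-*ˡ k f (x ∷ xs) = trans (cong (k * f x +_) (∑-*ˡ k f xs)) (sym (ℕ.*-distribˡ-+ k (f x) _))

  ∑-const : (k : ℕ) (xs : List A) → ∑[ x ∈ xs ] k ≡ length xs * k
  ∑-const k [] = refl
  ∑-const k (x ∷ xs) = cong (k +_) (∑-const k xs)

  ∑-zero : (xs : List A) → ∑[ x ∈ xs ] 0 ≡ 0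
  ∑-zero xs = trans (∑-const 0 xs) (ℕ.*-zeroʳ (length xs))

  module _ (_≟_ : DecidableEquality A) where

    ∑-𝟙≡-∉ : ∀ {t} {xs} → All (t ≢_) xs → ∑[ x ∈ xs ] 𝟙 (does (x ≟ t)) ≡ 0
    ∑-𝟙≡-∉ [] = refl
    ∑-𝟙≡-∉ {t} {x ∷ xs} (t≢x ∷ t∉xs) rewrite dec-false (x ≟ t) (t≢x ∘ sym) = ∑-𝟙≡-∉ t∉xs

    ∑-𝟙≡-unique : ∀ {t} {xs} → Unique xs → t ∈ xs → ∑[ x ∈ xs ] 𝟙 (does (x ≟ t)) ≡ 1
    ∑-𝟙≡-unique {t} (t∉xs ∷ _) (here refl) rewrite dec-true (t ≟ t) refl = cong suc (∑-𝟙≡-∉ t∉xs)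
    ∑-𝟙≡-unique {t} {x ∷ _} (x∉xs ∷ xs!) (there t∈xs)
      rewrite dec-false (x ≟ t) (All.lookup x∉xs t∈xs) = ∑-𝟙≡-unique xs! t∈xs

module _ {a b} {A : Set a} {B : Set b} where
  open Nat using (_+_)

  pairs : List A → List B → List (A × B)
  pairs xs ys = concatMap (λ x → map (x ,_) ys) xs

  ∑-pairs : (g : A × B → ℕ) (xs : List A) (ys : List B) →
            ∑ (pairs xs ys) g ≡ ∑[ x ∈ xs ] ∑[ y ∈ ys ] g (x , y)
  ∑-pairs g [] ys = refl
  ∑-pairs g (x ∷ xs) ys = begin
    sum (map g (map (x ,_) ys ++ pairs xs ys))
      ≡⟨ cong sum (map-++ g (map (x ,_) ys) (pairs xs ys)) ⟩
    sum (map g (map (x ,_) ys) ++ map g (pairs xs ys)) ≡⟨ sum-++ (map g (map (x ,_) ys)) _ ⟩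
    sum (map g (map (x ,_) ys)) + ∑ (pairs xs ys) g
      ≡⟨ cong₂ _+_ (cong sum (sym (map-∘ ys))) (∑-pairs g xs ys) ⟩
    ∑[ y ∈ ys ] g (x , y) + ∑[ x ∈ xs ] ∑[ y ∈ ys ] g (x , y) ∎
    where open ≡-Reasoning

  ∑-comm : (f : A → B → ℕ) (xs : List A) (ys : List B) →
           ∑[ x ∈ xs ] ∑[ y ∈ ys ] f x y ≡ ∑[ y ∈ ys ] ∑[ x ∈ xs ] f x y
  ∑-comm f [] ys = sym (∑-zero ys)
  ∑-comm f (x ∷ xs) ys = trans (cong (∑ ys (f x) +_) (∑-comm f xs ys))
                               (sym (∑-+ (f x) (λ y → ∑[ x ∈ xs ] f x y) ys))

p∣m^n⇒p∣m : ∀ {p m} n → Prime p → p ∣ m ^ n → p ∣ m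
p∣m^n⇒p∣m zero pp p∣1 = contradiction (subst Prime (∣1⇒≡1 p∣1) pp) ¬prime[1]
p∣m^n⇒p∣m {m = m} (suc n) pp p∣m^[1+n] with euclidsLemma m (m ^ n) pp p∣m^[1+n]
... | inj₁ p∣m = p∣m
... | inj₂ p∣m^n = p∣m^n⇒p∣m n pp p∣m^n

<?-flip : ∀ {n} {i j : Fin n} → i ≢ j → not (does (i Fin.<? j)) ≡ does (j Fin.<? i)
<?-flip {i = i} {j} i≢j with Fin.<-cmp i j
... | tri< i<j _ j≮i rewrite dec-true (i Fin.<? j) i<j | dec-false (j Fin.<? i) j≮i = refl
... | tri≈ _ i≡j _ = contradiction i≡j i≢j
... | tri> i≮j _ j<i rewrite dec-false (i Fin.<? j) i≮j | dec-true (j Fin.<? i) j<i = refl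

module _ {ℓ} (F : FiniteField ℓ) where
  open FiniteField F

  commutativeRing : CommutativeRing ℓ ℓ
  commutativeRing = record { isCommutativeRing = isCommutativeRing }

  open CommutativeRing commutativeRing
    using (+-assoc; +-comm; +-identityʳ; -‿inverseʳ; *-assoc; *-comm; *-identityˡ; distribˡ; distribʳ; zeroˡ; zeroʳ; ring)
  open RingProperties ring
    using (-‿distribˡ-*; -‿distribʳ-*; -‿involutive; +-inverseˡ-unique; +-identityʳ-unique; //-rightDividesˡ; //-rightDividesʳ)
  open ≡-Reasoning

  *-cancelˡ : ∀ {x y z} → x ≢ 0# → x * y ≡ x * z → y ≡ z
  *-cancelˡ {x} {y} {z} x≢0 xy≡xz = begin
    y                ≡⟨ u≡x⁻¹[xu] y ⟩
    x⁻¹ * (x * y)    ≡⟨ cong (x⁻¹ *_) xy≡xz ⟩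
    x⁻¹ * (x * z)    ≡⟨ u≡x⁻¹[xu] z ⟨
    z                ∎
    where
    x⁻¹ : Carrier
    x⁻¹ = proj₁ (inverse x x≢0)
    u≡x⁻¹[xu] : ∀ u → u ≡ x⁻¹ * (x * u)
    u≡x⁻¹[xu] u = begin
      u              ≡⟨ *-identityˡ u ⟨
      1# * u         ≡⟨ cong (_* u) (trans (sym (proj₂ (inverse x x≢0))) (*-comm x x⁻¹)) ⟩
      x⁻¹ * x * u    ≡⟨ *-assoc x⁻¹ x u ⟩
      x⁻¹ * (x * u)  ∎

  *-cancelʳ : ∀ {x y z} → x ≢ 0# → y * x ≡ z * x → y ≡ z
  *-cancelʳ {x} {y} {z} x≢0 yx≡zx = *-cancelˡ x≢0 (trans (*-comm x y) (trans yx≡zx (*-comm z x)))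

  x*y≡0⇒x≡0⊎y≡0 : ∀ x y → x * y ≡ 0# → x ≡ 0# ⊎ y ≡ 0#
  x*y≡0⇒x≡0⊎y≡0 x y xy≡0 with x ≟ 0#
  ... | yes x≡0 = inj₁ x≡0
  ... | no x≢0 = inj₂ (*-cancelˡ x≢0 (trans xy≡0 (sym (zeroʳ x))))

  -x*-x≡x*x : ∀ x → (- x) * (- x) ≡ x * x
  -x*-x≡x*x x = begin
    (- x) * (- x)   ≡⟨ -‿distribˡ-* x (- x) ⟨
    - (x * - x)     ≡⟨ cong -_ (-‿distribʳ-* x x) ⟨
    - (- (x * x))   ≡⟨ -‿involutive (x * x) ⟩
    x * x           ∎

  x*x≡y*y⇒x≡±y : ∀ x y → x * x ≡ y * y → x ≡ y ⊎ x ≡ - y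
  x*x≡y*y⇒x≡±y x y x²≡y² with (x + y) ≟ 0#
  ... | yes x+y≡0 = inj₂ (+-inverseˡ-unique x y x+y≡0)
  ... | no x+y≢0 = inj₁ (*-cancelʳ x+y≢0 (begin
    x * (x + y)      ≡⟨ distribˡ x x y ⟩
    x * x + x * y    ≡⟨ cong₂ _+_ x²≡y² (*-comm x y) ⟩
    y * y + y * x    ≡⟨ +-comm (y * y) (y * x) ⟩
    y * x + y * y    ≡⟨ distribˡ y x y ⟨
    y * (x + y)      ∎))

  x≢-x : 1# + 1# ≢ 0# → ∀ {x} → x ≢ 0# → x ≢ - x
  x≢-x 2≢0 {x} x≢0 x≡-x = [ 2≢0 , x≢0 ] (x*y≡0⇒x≡0⊎y≡0 (1# + 1#) x [1+1]x≡0)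
    where
    [1+1]x≡0 : (1# + 1#) * x ≡ 0#
    [1+1]x≡0 = begin
      (1# + 1#) * x     ≡⟨ distribʳ x 1# 1# ⟩
      1# * x + 1# * x   ≡⟨ cong₂ _+_ (*-identityˡ x) (*-identityˡ x) ⟩
      x + x             ≡⟨ cong (x +_) x≡-x ⟩
      x + - x           ≡⟨ -‿inverseʳ x ⟩
      0#                ∎

  elems-unique : Unique elems
  elems-unique = Unique.map⁺ (Injection.injective (↔⇒↣ enum)) (Unique.allFin⁺ size)

  ∈-elems : ∀ t → t ∈ elems
  ∈-elems t = subst (_∈ elems) (Inverse.strictlyInverseˡ enum t) (∈-map⁺ (Inverse.to enum) (∈-allFin (Inverse.from enum t)))

  length-elems : length elems ≡ size
  length-elems = trans (length-map (Inverse.to enum) (allFin size)) (length-tabulate (λ i → i))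

  ∑-𝟙≡ : ∀ t → ∑[ y ∈ elems ] 𝟙 (does (y ≟ t)) ≡ 1
  ∑-𝟙≡ t = ∑-𝟙≡-unique _≟_ elems-unique (∈-elems t)

  ∑-select : ∀ t (h : Carrier → ℕ) → ∑[ y ∈ elems ] (𝟙 (does (y ≟ t)) Nat.* h y) ≡ h t
  ∑-select t h = begin
    ∑[ y ∈ elems ] (𝟙 (does (y ≟ t)) Nat.* h y)  ≡⟨ ∑-cong select elems ⟩
    ∑[ y ∈ elems ] (h t Nat.* 𝟙 (does (y ≟ t)))  ≡⟨ ∑-*ˡ (h t) (λ y → 𝟙 (does (y ≟ t))) elems ⟩
    h t Nat.* ∑[ y ∈ elems ] 𝟙 (does (y ≟ t))    ≡⟨ cong (h t Nat.*_) (∑-𝟙≡ t) ⟩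
    h t Nat.* 1                                   ≡⟨ ℕ.*-identityʳ (h t) ⟩
    h t                                           ∎
    where
    select : ∀ y → 𝟙 (does (y ≟ t)) Nat.* h y ≡ h t Nat.* 𝟙 (does (y ≟ t))
    select y with y ≟ t
    ... | yes refl = ℕ.*-comm 1 (h y)
    ... | no _ = sym (ℕ.*-zeroʳ (h t))

  ∑-reindex : (f g : Carrier → Carrier) → (∀ x → g (f x) ≡ x) → (∀ y → f (g y) ≡ y) →
              (h : Carrier → ℕ) → ∑[ x ∈ elems ] h (f x) ≡ ∑[ y ∈ elems ] h y
  ∑-reindex f g gf fg h = begin
    ∑[ x ∈ elems ] h (f x)
      ≡⟨ ∑-cong (λ x → ∑-select (f x) h) elems ⟨
    ∑[ x ∈ elems ] ∑[ y ∈ elems ] (𝟙 (does (y ≟ f x)) Nat.* h y)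
      ≡⟨ ∑-comm (λ x y → 𝟙 (does (y ≟ f x)) Nat.* h y) elems elems ⟩
    ∑[ y ∈ elems ] ∑[ x ∈ elems ] (𝟙 (does (y ≟ f x)) Nat.* h y)
      ≡⟨ ∑-cong (λ y → ∑-cong (λ x → cong (λ b → 𝟙 b Nat.* h y) (y≡fx⇔x≡gy x y)) elems) elems ⟩
    ∑[ y ∈ elems ] ∑[ x ∈ elems ] (𝟙 (does (x ≟ g y)) Nat.* h y)
      ≡⟨ ∑-cong (λ y → ∑-select (g y) (λ _ → h y)) elems ⟩
    ∑[ y ∈ elems ] h y ∎
    where
    y≡fx⇔x≡gy : ∀ x y → does (y ≟ f x) ≡ does (x ≟ g y)
    y≡fx⇔x≡gy x y = does-⇔ (mk⇔ (λ y≡fx → trans (sym (gf x)) (cong g (sym y≡fx)))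
                                 (λ x≡gy → trans (sym (fg y)) (cong f (sym x≡gy))))
                           (y ≟ f x) (x ≟ g y)

  ∑-affine : ∀ {k} → k ≢ 0# → ∀ m (h : Carrier → ℕ) → ∑[ x ∈ elems ] h (k * x + m) ≡ ∑[ u ∈ elems ] h u
  ∑-affine {k} k≢0 m = ∑-reindex (λ x → k * x + m) (λ u → k⁻¹ * (u + - m)) g∘f f∘g
    where
    k⁻¹ : Carrier
    k⁻¹ = proj₁ (inverse k k≢0)
    g∘f : ∀ x → k⁻¹ * ((k * x + m) + - m) ≡ x
    g∘f x = *-cancelˡ k≢0 (begin
      k * (k⁻¹ * ((k * x + m) + - m))  ≡⟨ *-assoc k k⁻¹ _ ⟨
      k * k⁻¹ * ((k * x + m) + - m)
        ≡⟨ cong₂ _*_ (proj₂ (inverse k k≢0)) (//-rightDividesʳ m (k * x)) ⟩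
      1# * (k * x)                     ≡⟨ *-identityˡ (k * x) ⟩
      k * x                            ∎)
    f∘g : ∀ u → k * (k⁻¹ * (u + - m)) + m ≡ u
    f∘g u = begin
      k * (k⁻¹ * (u + - m)) + m  ≡⟨ cong (_+ m) (*-assoc k k⁻¹ _) ⟨
      k * k⁻¹ * (u + - m) + m    ≡⟨ cong (λ e → e * (u + - m) + m) (proj₂ (inverse k k≢0)) ⟩
      1# * (u + - m) + m         ≡⟨ cong (_+ m) (*-identityˡ (u + - m)) ⟩
      u + - m + m                ≡⟨ //-rightDividesˡ m u ⟩
      u                          ∎

  ∑-𝟙[x²≡s²] : 1# + 1# ≢ 0# → ∀ {s} → s ≢ 0# → ∑[ x ∈ elems ] 𝟙 (does ((x * x) ≟ (s * s))) ≡ 2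
  ∑-𝟙[x²≡s²] 2≢0 {s} s≢0 = begin
    ∑[ x ∈ elems ] 𝟙 (does ((x * x) ≟ (s * s)))
      ≡⟨ ∑-cong roots elems ⟩
    ∑[ x ∈ elems ] (𝟙 (does (x ≟ s)) Nat.+ 𝟙 (does (x ≟ (- s))))
      ≡⟨ ∑-+ (λ x → 𝟙 (does (x ≟ s))) (λ x → 𝟙 (does (x ≟ (- s)))) elems ⟩
    ∑[ x ∈ elems ] 𝟙 (does (x ≟ s)) Nat.+ ∑[ x ∈ elems ] 𝟙 (does (x ≟ (- s)))
      ≡⟨ cong₂ Nat._+_ (∑-𝟙≡ s) (∑-𝟙≡ (- s)) ⟩
    2 ∎
    where
    roots : ∀ x → 𝟙 (does ((x * x) ≟ (s * s))) ≡ 𝟙 (does (x ≟ s)) Nat.+ 𝟙 (does (x ≟ (- s)))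
    roots x with x ≟ s | x ≟ (- s)
    ... | yes refl | yes s≡-s = contradiction s≡-s (x≢-x 2≢0 s≢0)
    ... | yes refl | no _ rewrite dec-true ((s * s) ≟ (s * s)) refl = refl
    ... | no _ | yes refl rewrite dec-true (((- s) * (- s)) ≟ (s * s)) (-x*-x≡x*x s) = refl
    ... | no x≢s | no x≢-s rewrite dec-false ((x * x) ≟ (s * s)) ([ x≢s , x≢-s ] ∘ x*x≡y*y⇒x≡±y x s) = refl

  inSQ⇒≢0 : ∀ {r} → T (inSQ r) → r ≢ 0#
  inSQ⇒≢0 {r} r∈SQ with r ≟ 0#
  ... | no r≢0 = r≢0

  inSQ⇒nonzeroSquare : ∀ {r} → T (inSQ r) → ∃ λ s → s ≢ 0# × s * s ≡ r
  inSQ⇒nonzeroSquare {r} r∈SQ with r ≟ 0#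
  ... | no r≢0 with satisfied (any⁻ (λ y → does ((y * y) ≟ r)) elems r∈SQ)
  ...   | s , s²≡r? = s , s≢0 , s²≡r
    where
    s²≡r : s * s ≡ r
    s²≡r = T-does⇒ ((s * s) ≟ r) s²≡r?
    s≢0 : s ≢ 0#
    s≢0 refl = r≢0 (trans (sym s²≡r) (zeroˡ 0#))

  ∑-𝟙[[kx+m]²≡r] : 1# + 1# ≢ 0# → ∀ {k} → k ≢ 0# → ∀ m {r} → T (inSQ r) →
                   ∑[ x ∈ elems ] 𝟙 (does (sq (k * x + m) ≟ r)) ≡ 2
  ∑-𝟙[[kx+m]²≡r] 2≢0 k≢0 m r∈SQ with inSQ⇒nonzeroSquare r∈SQ
  ... | s , s≢0 , refl = trans (∑-affine k≢0 m (λ u → 𝟙 (does (sq u ≟ (s * s))))) (∑-𝟙[x²≡s²] 2≢0 s≢0)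

  ∑-elems² : (g : Carrier × Carrier → ℕ) → ∑ elems² g ≡ ∑[ x ∈ elems ] ∑[ y ∈ elems ] g (x , y)
  ∑-elems² g = ∑-pairs g elems elems

  ∑-elems³ : (g : Carrier × Carrier × Carrier → ℕ) →
             ∑ elems³ g ≡ ∑[ x ∈ elems ] ∑[ y ∈ elems ] ∑[ z ∈ elems ] g (x , y , z)
  ∑-elems³ g = trans (∑-pairs g elems elems²) (∑-cong (λ x → ∑-elems² (λ p → g (x , p))) elems)

  ∑-elems⁴ : (g : Carrier × Carrier × Carrier × Carrier → ℕ) →
             ∑ elems⁴ g ≡ ∑[ x ∈ elems ] ∑[ y ∈ elems ] ∑[ z ∈ elems ] ∑[ t ∈ elems ] g (x , y , z , t)
  ∑-elems⁴ g = trans (∑-pairs g elems elems³) (∑-cong (λ x → ∑-elems³ (λ p → g (x , p))) elems)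

  ∑∑-𝟙[[ax+by+c]²≡r] : 1# + 1# ≢ 0# → ∀ {a b} → ¬ (a ≡ 0# × b ≡ 0#) → ∀ c {r} → T (inSQ r) →
                        ∑[ x ∈ elems ] ∑[ y ∈ elems ] 𝟙 (does (sq (a * x + b * y + c) ≟ r)) ≡ 2 Nat.* size
  ∑∑-𝟙[[ax+by+c]²≡r] 2≢0 {a} {b} ab≢0 c {r} r∈SQ with b ≟ 0#
  ... | no b≢0 = begin
    ∑[ x ∈ elems ] ∑[ y ∈ elems ] 𝟙 (does (sq (a * x + b * y + c) ≟ r))
      ≡⟨ ∑-cong (λ x → ∑-cong (λ y → cong (λ u → 𝟙 (does (sq u ≟ r))) (shuffle x y)) elems) elems ⟩
    ∑[ x ∈ elems ] ∑[ y ∈ elems ] 𝟙 (does (sq (b * y + (a * x + c)) ≟ r))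
      ≡⟨ ∑-cong (λ x → ∑-𝟙[[kx+m]²≡r] 2≢0 b≢0 (a * x + c) r∈SQ) elems ⟩
    ∑[ x ∈ elems ] 2
      ≡⟨ ∑-const 2 elems ⟩
    length elems Nat.* 2
      ≡⟨ cong (Nat._* 2) length-elems ⟩
    size Nat.* 2
      ≡⟨ ℕ.*-comm size 2 ⟩
    2 Nat.* size ∎
    where
    shuffle : ∀ x y → a * x + b * y + c ≡ b * y + (a * x + c)
    shuffle x y = trans (cong (_+ c) (+-comm (a * x) (b * y))) (+-assoc (b * y) (a * x) c)
  ... | yes refl = begin
    ∑[ x ∈ elems ] ∑[ y ∈ elems ] 𝟙 (does (sq (a * x + 0# * y + c) ≟ r))
      ≡⟨ ∑-cong (λ x → ∑-cong (λ y → cong (λ u → 𝟙 (does (sq u ≟ r))) (drop x y)) elems) elems ⟩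
    ∑[ x ∈ elems ] ∑[ y ∈ elems ] 𝟙 (does (sq (a * x + c) ≟ r))
      ≡⟨ ∑-cong (λ x → ∑-const _ elems) elems ⟩
    ∑[ x ∈ elems ] (length elems Nat.* 𝟙 (does (sq (a * x + c) ≟ r)))
      ≡⟨ ∑-*ˡ (length elems) _ elems ⟩
    length elems Nat.* ∑[ x ∈ elems ] 𝟙 (does (sq (a * x + c) ≟ r))
      ≡⟨ cong₂ Nat._*_ length-elems (∑-𝟙[[kx+m]²≡r] 2≢0 a≢0 c r∈SQ) ⟩
    size Nat.* 2
      ≡⟨ ℕ.*-comm size 2 ⟩
    2 Nat.* size ∎
    where
    drop : ∀ x y → a * x + 0# * y + c ≡ a * x + c
    drop x y = cong (_+ c) (trans (cong (a * x +_) (zeroˡ y)) (+-identityʳ (a * x)))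
    a≢0 : a ≢ 0#
    a≢0 a≡0 = ab≢0 (a≡0 , refl)

  degree-A : 1# + 1# ≢ 0# → ∀ v → T (inA v) → count (adj v) elems² ≡ 2 Nat.* size
  degree-A 2≢0 v@(a , b , c , l) v∈A = begin
    count (adj v) elems²                                    ≡⟨ count≡∑𝟙 (adj v) elems² ⟩
    ∑[ p ∈ elems² ] 𝟙 (adj v p)                             ≡⟨ ∑-elems² (𝟙 ∘ adj v) ⟩
    ∑[ x ∈ elems ] ∑[ y ∈ elems ] 𝟙 (adj v (x , y))         ≡⟨ ∑∑-𝟙[[ax+by+c]²≡r] 2≢0 ab≢0 c r∈SQ ⟩
    2 Nat.* size                                            ∎
    where
    r∈SQ : T (inSQ (l * (sq a + sq b)))
    r∈SQ = subst (T ∘ inSQ) (*-comm (sq a + sq b) l) v∈A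
    ab≢0 : ¬ (a ≡ 0# × b ≡ 0#)
    ab≢0 (refl , refl) = inSQ⇒≢0 r∈SQ (begin
      l * (0# * 0# + 0# * 0#)  ≡⟨ cong (λ u → l * (u + u)) (zeroˡ 0#) ⟩
      l * (0# + 0#)            ≡⟨ cong (l *_) (+-identityʳ 0#) ⟩
      l * 0#                   ≡⟨ zeroʳ l ⟩
      0#                       ∎)

  ∑-𝟙[inA∧adj] : 1# + 1# ≢ 0# → ∀ x y a b l →
                 ∑[ c ∈ elems ] 𝟙 (inA (a , b , c , l) ∧ adj (a , b , c , l) (x , y)) ≡ 2 Nat.* 𝟙 (inS (a , b , l))
  ∑-𝟙[inA∧adj] 2≢0 x y a b l rewrite *-comm (sq a + sq b) l with inSQ (l * (sq a + sq b)) in r∈SQ?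
  ... | false = ∑-zero elems
  ... | true = trans (∑-cong (λ c → cong (λ u → 𝟙 (does (sq u ≟ (l * (sq a + sq b))))) (shift c)) elems)
                     (∑-𝟙[[kx+m]²≡r] 2≢0 1≢0 (a * x + b * y) (subst T (sym r∈SQ?) tt))
    where
    1≢0 : 1# ≢ 0#
    1≢0 = 0≢1 ∘ sym
    shift : ∀ c → a * x + b * y + c ≡ 1# * c + (a * x + b * y)
    shift c = trans (+-comm (a * x + b * y) c) (cong (_+ (a * x + b * y)) (sym (*-identityˡ c)))

  degree-B : 1# + 1# ≢ 0# → ∀ w → count (λ v → inA v ∧ adj v w) elems⁴ ≡ 2 Nat.* count inS elems³
  degree-B 2≢0 w@(x , y) = begin
    count (λ v → inA v ∧ adj v w) elems⁴
      ≡⟨ count≡∑𝟙 _ elems⁴ ⟩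
    ∑[ v ∈ elems⁴ ] 𝟙 (inA v ∧ adj v w)
      ≡⟨ ∑-elems⁴ _ ⟩
    ∑[ a ∈ elems ] ∑[ b ∈ elems ] ∑[ c ∈ elems ] ∑[ l ∈ elems ] G a b c l
      ≡⟨ ∑-cong (λ a → ∑-cong (λ b → ∑-comm (G a b) elems elems) elems) elems ⟩
    ∑[ a ∈ elems ] ∑[ b ∈ elems ] ∑[ l ∈ elems ] ∑[ c ∈ elems ] G a b c l
      ≡⟨ ∑-cong (λ a → ∑-cong (λ b → ∑-cong (∑-𝟙[inA∧adj] 2≢0 x y a b) elems) elems) elems ⟩
    ∑[ a ∈ elems ] ∑[ b ∈ elems ] ∑[ l ∈ elems ] (2 Nat.* S a b l)
      ≡⟨ ∑-cong (λ a → trans (∑-cong (λ b → ∑-*ˡ 2 (S a b) elems) elems) (∑-*ˡ 2 _ elems)) elems ⟩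
    ∑[ a ∈ elems ] (2 Nat.* ∑[ b ∈ elems ] ∑[ l ∈ elems ] S a b l)
      ≡⟨ ∑-*ˡ 2 _ elems ⟩
    2 Nat.* ∑[ a ∈ elems ] ∑[ b ∈ elems ] ∑[ l ∈ elems ] S a b l
      ≡⟨ cong (2 Nat.*_) (trans (sym (∑-elems³ (𝟙 ∘ inS))) (sym (count≡∑𝟙 inS elems³))) ⟩
    2 Nat.* count inS elems³
      ∎
    where
    G : Carrier → Carrier → Carrier → Carrier → ℕ
    G a b c l = 𝟙 (inA (a , b , c , l) ∧ adj (a , b , c , l) w)
    S : Carrier → Carrier → Carrier → ℕ
    S a b l = 𝟙 (inS (a , b , l))

  fixedPointFreeInvolution⇒2∣size : (f : Carrier → Carrier) → (∀ x → f (f x) ≡ x) → (∀ x → f x ≢ x) → 2 ∣ size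
  fixedPointFreeInvolution⇒2∣size f ff fx≢x = divides N (begin
    size
      ≡⟨ length-elems ⟨
    length elems
      ≡⟨ ℕ.*-identityʳ (length elems) ⟨
    length elems Nat.* 1
      ≡⟨ ∑-const 1 elems ⟨
    ∑[ x ∈ elems ] 1
      ≡⟨ ∑-cong (λ x → sym (𝟙-not (P x))) elems ⟩
    ∑[ x ∈ elems ] (𝟙 (P x) Nat.+ 𝟙 (not (P x)))
      ≡⟨ ∑-+ (𝟙 ∘ P) (λ x → 𝟙 (not (P x))) elems ⟩
    N Nat.+ ∑[ x ∈ elems ] 𝟙 (not (P x))
      ≡⟨ cong (N Nat.+_) (∑-cong (cong 𝟙 ∘ ¬P≡P∘f) elems) ⟩
    N Nat.+ ∑[ x ∈ elems ] 𝟙 (P (f x))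
      ≡⟨ cong (N Nat.+_) (∑-reindex f f ff ff (𝟙 ∘ P)) ⟩
    N Nat.+ N
      ≡⟨ cong (N Nat.+_) (ℕ.+-identityʳ N) ⟨
    2 Nat.* N
      ≡⟨ ℕ.*-comm 2 N ⟩
    N Nat.* 2 ∎)
    where
    from : Carrier → Fin size
    from = Inverse.from enum
    -- f pairs x with f x; P picks the member of each pair that comes first in the enumeration.
    P : Carrier → Bool
    P x = does (from x Fin.<? from (f x))
    N : ℕ
    N = ∑[ x ∈ elems ] 𝟙 (P x)
    ¬P≡P∘f : ∀ x → not (P x) ≡ P (f x)
    ¬P≡P∘f x = trans (<?-flip (fx≢x x ∘ sym ∘ Injection.injective (↔⇒↣ (↔-sym enum))))
                     (cong (λ z → does (from (f x) Fin.<? from z)) (sym (ff x)))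

  char2⇒2∣size : 1# + 1# ≡ 0# → 2 ∣ size
  char2⇒2∣size 1+1≡0 = fixedPointFreeInvolution⇒2∣size (_+ 1#) x+1+1≡x x+1≢x
    where
    x+1+1≡x : ∀ x → x + 1# + 1# ≡ x
    x+1+1≡x x = trans (+-assoc x 1# 1#) (trans (cong (x +_) 1+1≡0) (+-identityʳ x))
    x+1≢x : ∀ x → x + 1# ≢ x
    x+1≢x x x+1≡x = 0≢1 (sym (+-identityʳ-unique x 1# x+1≡x))

  oddPrimePower⇒1+1≢0 : OddPrimePower size → 1# + 1# ≢ 0#
  oddPrimePower⇒1+1≢0 (p , k , _ , 2∤p , size≡p^[1+k]) 1+1≡0 =
    2∤p (p∣m^n⇒p∣m (suc k) prime[2] (subst (2 ∣_) size≡p^[1+k] (char2⇒2∣size 1+1≡0)))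

lemma6p1 : ∀ {ℓ : Level} (F : FiniteField ℓ) → OddPrimePower (FiniteField.size F) → PLDegrees F
lemma6p1 F q-odd = degree-A F 1+1≢0 , degree-B F 1+1≢0
  where
  open FiniteField F using (_+_; 1#; 0#)
  1+1≢0 : 1# + 1# ≢ 0#
  1+1≢0 = oddPrimePower⇒1+1≢0 F q-odd
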